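{- Let $n\geq 2$ and $A\in\mathrm{Int}(n)$. Then $f(A)\in\mathrm{Int}(n-1)$.
   Context: For $n\in\mathbb{N}$, $\mathrm{Int}(n)$ denotes the set of upper triangular square matrices with non-negative integer entries summing to $n$ such that every row and every column contains at least one non-zero entry. For $A\in\mathrm{Int}(n)$ let $\dim(A)$ be the number of rows of $A$, let $\mathrm{index}(A)$ be the smallest $i$ with $A_{i,\dim(A)}>0$, and let $\mathrm{val}(A)=A_{\mathrm{index}(A),\dim(A)}$. The removal operation $f$ is defined on $A\in\mathrm{Int}(n)$ ($n\ge 2$) as follows. (Rem1) If $\mathrm{val}(A)>1$, or if $\mathrm{val}(A)=1$, $\mathrm{index}(A)<\dim(A)$ and row $\mathrm{index}(A)$ contains at least one other positive entry, then $f(A)$ is $A$ with the entry at position $(\mathrm{index}(A),\dim(A))$ decreased by $1$. (Rem2) If $\mathrm{val}(A)=1$ and $\mathrm{index}(A)=\dim(A)$, then $f(A)$ is $A$ with its last row and last column deleted. (Rem3) If $\mathrm{val}(A)=1$, $\mathrm{index}(A)<\dim(A)$ and all other entries of row $\mathrm{index}(A)$ are $0$, then set $A_{i,\dim(A)}:=A_{i,\mathrm{index}(A)}$ for all $1\le i\le \mathrm{index}(A)-1$, and then delete row $\mathrm{index}(A)$ and column $\mathrm{index}(A)$; the resulting $(\dim(A)-1)\times(\dim(A)-1)$ matrix is $f(A)$. -}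

module Defs where

open import Data.Nat using (ℕ; zero; suc; _+_; _<_; _∸_; pred)
open import Data.Fin using (Fin; zero; suc; toℕ; fromℕ; inject₁; punchIn; _≟_)
open import Data.Fin.Properties using (any?)
open import Data.Maybe using (Maybe; just; nothing)
import Data.Maybe as Maybe
open import Data.Product using (Σ; ∃; _,_; _×_)
open import Data.Bool using (Bool; true; false; if_then_else_; _∧_)
open import Relation.Nullary using (¬_; yes; no; Dec)
open import Relation.Nullary.Decidable using (⌊_⌋)
open import Relation.Binary.PropositionalEquality using (_≡_)
import Data.Nat as ℕ

Mat : ℕ → Set
Mat d = Fin d → Fin d → ℕ

SqMat : Set
SqMat = Σ ℕ Mat

ΣFin : {m : ℕ} → (Fin m → ℕ) → ℕ
ΣFin {zero}  v = 0
ΣFin {suc m} v = v zero + ΣFin (λ i → v (suc i))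

total : {d : ℕ} → Mat d → ℕ
total M = ΣFin (λ i → ΣFin (λ j → M i j))

record InInt (n : ℕ) (A : SqMat) : Set where
  constructor mkInInt
  field
    upper  : ∀ (i j : Fin (Σ.proj₁ A)) → toℕ j < toℕ i → Σ.proj₂ A i j ≡ 0
    sumIs  : total (Σ.proj₂ A) ≡ n
    rowNZ  : ∀ (i : Fin (Σ.proj₁ A)) → ∃ λ j → 0 < Σ.proj₂ A i j
    colNZ  : ∀ (j : Fin (Σ.proj₁ A)) → ∃ λ i → 0 < Σ.proj₂ A i j

firstPos : {m : ℕ} → (Fin m → ℕ) → Maybe (Fin m)
firstPos {zero}  v = nothing
firstPos {suc m} v with v zero
... | zero  = Maybe.map suc (firstPos (λ i → v (suc i)))
... | suc _ = just zero

decAt : {d : ℕ} → Fin d → Fin d → Mat d → Mat d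
decAt r c M a b = if ⌊ a ≟ r ⌋ ∧ ⌊ b ≟ c ⌋ then pred (M a b) else M a b

-- Rem3 on a matrix of dimension suc k with index r (r ≠ last):
-- set A_{a,last} := A_{a,r} for a < r, then delete row r and column r.
rem3 : {k : ℕ} → Fin (suc k) → Mat (suc k) → Mat k
rem3 {k} r M a b = M' (punchIn r a) (punchIn r b)
  where
  M' : Mat (suc k)
  M' x y = if ⌊ y ≟ fromℕ k ⌋ ∧ ⌊ toℕ x ℕ.<? toℕ r ⌋ then M x r else M x y

rem2 : {k : ℕ} → Mat (suc k) → Mat k
rem2 M a b = M (inject₁ a) (inject₁ b)

otherPos : {d : ℕ} → Mat d → Fin d → Fin d → Bool
otherPos M r c = ⌊ any? (λ j → ¬? (j ≟ c) ×-dec (0 ℕ.<? M r j)) ⌋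
  where
  open import Relation.Nullary using (¬?)
  open import Relation.Nullary.Decidable using (_×-dec_)

-- The removal operation f.  (On inputs outside its intended domain —
-- dimension 0, or no positive entry in the last column — it returns
-- the input unchanged; this never happens for A ∈ Int(n), n ≥ 2.)
f : SqMat → SqMat
f (zero , M) = (zero , M)
f (suc k , M) with firstPos (λ i → M i (fromℕ k))
... | nothing = (suc k , M)
... | just r with M r (fromℕ k)
...   | zero = (suc k , M)                                   -- impossible
...   | suc (suc _) = (suc k , decAt r (fromℕ k) M)          -- Rem1, val > 1
...   | suc zero with r ≟ fromℕ k
...     | yes _ = (k , rem2 M)
...     | no _ = if otherPos M r (fromℕ k)
                   then (suc k , decAt r (fromℕ k) M)        -- Rem1, val = 1
                   else (k , rem3 r M)

module Submission where

-- Every removal step removes exactly one unit of mass. In Rem2 and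
-- Rem3 the deleted row is the unit vector at the last column, and each surviving row keeps its sum:
-- in Rem3 the column-index(A) entries of the rows above index(A) move into the last column, where
-- minimality of index(A) guarantees zeros, and below the diagonal that column vanishes anyway.
-- Triangularity survives since punchIn is monotone; a nonzero row or column could only be lost if its
-- positive entry sat in the deleted row or column, which triangularity, the minimality of index(A)
-- and the emptiness of row index(A) off the last column rule out.

open import Data.Bool using (true; false)
open import Data.Fin as Fin using (Fin; zero; suc; toℕ; fromℕ; inject₁; punchIn; punchOut; _≟_)
open import Data.Fin.Properties
  using (any?; ≤fromℕ; ≤∧≢⇒<; punchInᵢ≢i; punchIn-injective; punchIn-cancel-≤; punchIn-punchOut)
open import Data.Maybe using (just; nothing)
open import Data.Nat using (ℕ; zero; suc; pred; _+_; _∸_; _≤_; _<_; z<s; s<s; _<?_; >-nonZero)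
open import Data.Nat.Properties
  using (+-assoc; +-comm; +-identityʳ; n≤0⇒n≡0; ≮⇒≥; n>0⇒n≢0; m<n⇒n≢0; <⇒≱; ≰⇒>; pred[n]≤n; ≤-refl;
         suc-pred)
open import Data.Product using (∃; _×_; _,_; proj₁; proj₂)
open import Function using (_∘_)
open import Relation.Binary.PropositionalEquality using (_≡_; _≢_; refl; sym; trans; cong; cong₂; subst)
open import Relation.Nullary using (¬?; Dec; yes; no; contradiction)
open import Relation.Nullary.Decidable using (_×-dec_)

open import Defs
open Relation.Binary.PropositionalEquality.≡-Reasoning

≡suc⇒≡∸1 : ∀ {x y n} → x ≡ suc y → x ≡ n → y ≡ n ∸ 1
≡suc⇒≡∸1 x≡1+y x≡n = cong pred (trans (sym x≡1+y) x≡n)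

ΣFin-cong : ∀ {m} {v w : Fin m → ℕ} → (∀ i → v i ≡ w i) → ΣFin v ≡ ΣFin w
ΣFin-cong {zero}  v≗w = refl
ΣFin-cong {suc m} v≗w = cong₂ _+_ (v≗w zero) (ΣFin-cong (λ i → v≗w (suc i)))

ΣFin-zeros : ∀ {m} {v : Fin m → ℕ} → (∀ i → v i ≡ 0) → ΣFin v ≡ 0
ΣFin-zeros {zero}  v≗0 = refl
ΣFin-zeros {suc m} v≗0 = cong₂ _+_ (v≗0 zero) (ΣFin-zeros (λ i → v≗0 (suc i)))

ΣFin-punchIn : ∀ {m} (p : Fin (suc m)) (v : Fin (suc m) → ℕ) →
               ΣFin v ≡ v p + ΣFin (λ i → v (punchIn p i))
ΣFin-punchIn zero    v = refl
ΣFin-punchIn {suc m} (suc p) v = begin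
  v zero + ΣFin (λ i → v (suc i))
    ≡⟨ cong (v zero +_) (ΣFin-punchIn p (λ i → v (suc i))) ⟩
  v zero + (v (suc p) + S)
    ≡⟨ sym (+-assoc (v zero) (v (suc p)) S) ⟩
  v zero + v (suc p) + S
    ≡⟨ cong (_+ S) (+-comm (v zero) (v (suc p))) ⟩
  v (suc p) + v zero + S
    ≡⟨ +-assoc (v (suc p)) (v zero) S ⟩
  v (suc p) + (v zero + S)
    ∎
  where
  S : ℕ
  S = ΣFin (λ i → v (suc (punchIn p i)))

ΣFin-single : ∀ {m} (p : Fin m) {v : Fin m → ℕ} →
              (∀ i → i ≢ p → v i ≡ 0) → ΣFin v ≡ v p
ΣFin-single {suc m} p {v} v≗0 = begin
  ΣFin v                                ≡⟨ ΣFin-punchIn p v ⟩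
  v p + ΣFin (λ i → v (punchIn p i))    ≡⟨ cong (v p +_) (ΣFin-zeros (λ i → v≗0 _ (punchInᵢ≢i p i))) ⟩
  v p + 0                               ≡⟨ +-identityʳ (v p) ⟩
  v p                                   ∎

ΣFin-decrement : ∀ {m} (p : Fin m) {v w : Fin m → ℕ} →
                 v p ≡ suc (w p) → (∀ i → i ≢ p → v i ≡ w i) → ΣFin v ≡ suc (ΣFin w)
ΣFin-decrement {suc m} p {v} {w} vp≡1+wp v≗w = begin
  ΣFin v                                    ≡⟨ ΣFin-punchIn p v ⟩
  v p + ΣFin (λ i → v (punchIn p i))        ≡⟨ cong₂ _+_ vp≡1+wp (ΣFin-cong (λ i → v≗w _ (punchInᵢ≢i p i))) ⟩
  suc (w p + ΣFin (λ i → w (punchIn p i)))  ≡⟨ cong suc (sym (ΣFin-punchIn p w)) ⟩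
  suc (ΣFin w)                              ∎

ΣFin-fill : ∀ {m} (p : Fin m) {v w : Fin m → ℕ} →
            w p ≡ 0 → (∀ i → i ≢ p → v i ≡ w i) → ΣFin v ≡ v p + ΣFin w
ΣFin-fill {suc m} p {v} {w} wp≡0 v≗w = begin
  ΣFin v                              ≡⟨ ΣFin-punchIn p v ⟩
  v p + ΣFin (λ i → v (punchIn p i))  ≡⟨ cong (v p +_) (ΣFin-cong (λ i → v≗w _ (punchInᵢ≢i p i))) ⟩
  v p + S                             ≡⟨ cong (λ x → v p + (x + S)) (sym wp≡0) ⟩
  v p + (w p + S)                     ≡⟨ cong (v p +_) (sym (ΣFin-punchIn p w)) ⟩
  v p + ΣFin w                        ∎
  where
  S : ℕ
  S = ΣFin (λ i → w (punchIn p i))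

total-deleteRow : ∀ {k} (p : Fin (suc k)) (M : Mat (suc k)) (N : Mat k) → ΣFin (M p) ≡ 1 →
                  (∀ a → ΣFin (N a) ≡ ΣFin (M (punchIn p a))) → total M ≡ suc (total N)
total-deleteRow p M N rowSum≡1 rowSums = begin
  total M                                             ≡⟨ ΣFin-punchIn p (λ i → ΣFin (M i)) ⟩
  ΣFin (M p) + ΣFin (λ a → ΣFin (M (punchIn p a)))    ≡⟨ cong₂ _+_ rowSum≡1 (sym (ΣFin-cong rowSums)) ⟩
  suc (total N)                                       ∎

≢fromℕ⇒<fromℕ : ∀ {k} {j : Fin (suc k)} → j ≢ fromℕ k → j Fin.< fromℕ k
≢fromℕ⇒<fromℕ {j = j} j≢k = ≤∧≢⇒< (≤fromℕ j) j≢k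

punchIn-mono-< : ∀ {k} (p : Fin (suc k)) {i j : Fin k} → i Fin.< j → punchIn p i Fin.< punchIn p j
punchIn-mono-< p {i} {j} i<j = ≰⇒> (λ pj≤pi → <⇒≱ i<j (punchIn-cancel-≤ p j i pj≤pi))

punchIn-fromℕ : ∀ {k} (i : Fin k) → punchIn (fromℕ k) i ≡ inject₁ i
punchIn-fromℕ zero    = refl
punchIn-fromℕ (suc i) = cong suc (punchIn-fromℕ i)

firstPos-nothing : ∀ {m} (v : Fin m → ℕ) → firstPos v ≡ nothing → ∀ i → v i ≡ 0
firstPos-nothing {suc m} v eq i with v zero in v0
firstPos-nothing {suc m} v () i | suc _
... | zero with firstPos (λ i → v (suc i)) in rest
firstPos-nothing {suc m} v () i       | zero | just _
firstPos-nothing {suc m} v eq zero    | zero | nothing = v0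
firstPos-nothing {suc m} v eq (suc i) | zero | nothing = firstPos-nothing (λ i → v (suc i)) rest i

firstPos-just : ∀ {m} (v : Fin m → ℕ) {r : Fin m} → firstPos v ≡ just r →
                0 < v r × (∀ i → i Fin.< r → v i ≡ 0)
firstPos-just {suc m} v eq with v zero in v0
firstPos-just {suc m} v refl | suc _ = subst (0 <_) (sym v0) z<s , λ _ ()
... | zero with firstPos (λ i → v (suc i)) in rest
firstPos-just {suc m} v ()   | zero | nothing
firstPos-just {suc m} v refl | zero | just r with firstPos-just (λ i → v (suc i)) rest
... | pos , minimal = pos , λ { zero _ → v0 ; (suc i) (s<s i<r) → minimal i i<r }

decAt-same : ∀ {d} (r c : Fin d) (M : Mat d) → decAt r c M r c ≡ pred (M r c)
decAt-same r c M with r ≟ r | c ≟ c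
... | yes _  | yes _  = refl
... | no r≢r | _      = contradiction refl r≢r
... | yes _  | no c≢c = contradiction refl c≢c

decAt-otherRow : ∀ {d} {r c a : Fin d} (M : Mat d) b → a ≢ r → decAt r c M a b ≡ M a b
decAt-otherRow {r = r} {a = a} M b a≢r with a ≟ r
... | yes a≡r = contradiction a≡r a≢r
... | no _    = refl

decAt-otherCol : ∀ {d} {r c b : Fin d} (M : Mat d) a → b ≢ c → decAt r c M a b ≡ M a b
decAt-otherCol {r = r} {c} {b} M a b≢c with a ≟ r | b ≟ c
... | _     | yes b≡c = contradiction b≡c b≢c
... | yes _ | no _    = refl
... | no _  | no _    = refl

decAt-≤ : ∀ {d} (r c : Fin d) (M : Mat d) a b → decAt r c M a b ≤ M a b
decAt-≤ r c M a b with a ≟ r | b ≟ c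
... | yes _ | yes _ = pred[n]≤n
... | yes _ | no _  = ≤-refl
... | no _  | _     = ≤-refl

otherPos-true : ∀ {d} (M : Mat d) r c → otherPos M r c ≡ true → ∃ λ j → j ≢ c × 0 < M r j
otherPos-true M r c eq with any? (λ j → ¬? (j ≟ c) ×-dec (0 <? M r j))
otherPos-true M r c refl | yes witness = witness

otherPos-false : ∀ {d} (M : Mat d) r c → otherPos M r c ≡ false → ∀ j → j ≢ c → M r j ≡ 0
otherPos-false M r c eq j j≢c with any? (λ j → ¬? (j ≟ c) ×-dec (0 <? M r j))
otherPos-false M r c refl j j≢c | no none with M r j in Mrj
... | zero  = refl
... | suc _ = contradiction (j , j≢c , subst (0 <_) (sym Mrj) z<s) none

rem3-moved : ∀ {k} (r : Fin (suc k)) (M : Mat (suc k)) a b →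
             punchIn r b ≡ fromℕ k → punchIn r a Fin.< r → rem3 r M a b ≡ M (punchIn r a) r
rem3-moved {k} r M a b Pb≡k Pa<r with punchIn r b ≟ fromℕ k | toℕ (punchIn r a) <? toℕ r
... | yes _   | yes _   = refl
... | no Pb≢k | _       = contradiction Pb≡k Pb≢k
... | yes _   | no Pa≮r = contradiction Pa<r Pa≮r

rem3-kept : ∀ {k} (r : Fin (suc k)) (M : Mat (suc k)) a b →
            (punchIn r a Fin.< r → punchIn r b ≢ fromℕ k) → rem3 r M a b ≡ M (punchIn r a) (punchIn r b)
rem3-kept {k} r M a b Pa<r⇒Pb≢k with punchIn r b ≟ fromℕ k | toℕ (punchIn r a) <? toℕ r
... | yes Pb≡k | yes Pa<r = contradiction Pb≡k (Pa<r⇒Pb≢k Pa<r)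
... | yes _    | no _     = refl
... | no _     | _        = refl

punchIn-preimage : ∀ {k} (p j : Fin (suc k)) → j ≢ p → ∃ λ i → punchIn p i ≡ j
punchIn-preimage p j j≢p = punchOut (j≢p ∘ sym) , punchIn-punchOut (j≢p ∘ sym)

lastDiagonal-pos : ∀ {n k} {M : Mat (suc k)} → InInt n (suc k , M) → 0 < M (fromℕ k) (fromℕ k)
lastDiagonal-pos {k = k} A with InInt.rowNZ A (fromℕ k)
... | j , pos with j ≟ fromℕ k
...   | yes refl = pos
...   | no j≢k   = contradiction (InInt.upper A (fromℕ k) j (≢fromℕ⇒<fromℕ j≢k)) (n>0⇒n≢0 pos)

decAt-InInt : ∀ {n d} {M : Mat d} {r c : Fin d} → InInt n (d , M) → 0 < M r c →
              (∃ λ j → 0 < decAt r c M r j) → (∃ λ i → 0 < decAt r c M i c) →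
              InInt (n ∸ 1) (d , decAt r c M)
decAt-InInt {d = d} {M} {r} {c} A Mrc>0 rowPos colPos =
  mkInInt upper′ (≡suc⇒≡∸1 total≡1+ sumIs) rowNZ′ colNZ′
  where
  open InInt A
  D : Mat d
  D = decAt r c M
  upper′ : ∀ i j → toℕ j < toℕ i → D i j ≡ 0
  upper′ i j j<i = n≤0⇒n≡0 (subst (D i j ≤_) (upper i j j<i) (decAt-≤ r c M i j))
  Mrc≡1+Drc : M r c ≡ suc (D r c)
  Mrc≡1+Drc = sym (trans (cong suc (decAt-same r c M)) (suc-pred (M r c) {{>-nonZero Mrc>0}}))
  total≡1+ : total M ≡ suc (total D)
  total≡1+ = ΣFin-decrement r (ΣFin-decrement c Mrc≡1+Drc (λ j j≢c → sym (decAt-otherCol M r j≢c)))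
                                (λ i i≢r → ΣFin-cong (λ j → sym (decAt-otherRow M j i≢r)))
  -- Testing r ≟ a rather than a ≟ r, which occurs inside decAt and would be abstracted by `with`.
  rowNZ′ : ∀ a → ∃ λ j → 0 < D a j
  rowNZ′ a with r ≟ a
  ... | yes refl = rowPos
  ... | no r≢a   = let j , pos = rowNZ a in j , subst (0 <_) (sym (decAt-otherRow M j (r≢a ∘ sym))) pos
  colNZ′ : ∀ b → ∃ λ i → 0 < D i b
  colNZ′ b with c ≟ b
  ... | yes refl = colPos
  ... | no c≢b   = let i , pos = colNZ b in i , subst (0 <_) (sym (decAt-otherCol M i (c≢b ∘ sym))) pos

decAt-InInt-entry>1 : ∀ {n d m} {M : Mat d} {r c : Fin d} → InInt n (d , M) → M r c ≡ suc (suc m) →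
                      InInt (n ∸ 1) (d , decAt r c M)
decAt-InInt-entry>1 {M = M} {r} {c} A Mrc≡2+m =
  decAt-InInt A (subst (0 <_) (sym Mrc≡2+m) z<s) (c , Drc>0) (r , Drc>0)
  where
  Drc>0 : 0 < decAt r c M r c
  Drc>0 = subst (0 <_) (sym (trans (decAt-same r c M) (cong pred Mrc≡2+m))) z<s

decAt-InInt-lastColumn : ∀ {n k} {M : Mat (suc k)} {r j : Fin (suc k)} → InInt n (suc k , M) →
                         r ≢ fromℕ k → 0 < M r (fromℕ k) → j ≢ fromℕ k → 0 < M r j →
                         InInt (n ∸ 1) (suc k , decAt r (fromℕ k) M)
decAt-InInt-lastColumn {k = k} {M} {r} {j} A r≢k Mrk>0 j≢k Mrj>0 = decAt-InInt A Mrk>0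
  (j , subst (0 <_) (sym (decAt-otherCol M r j≢k)) Mrj>0)
  (fromℕ k , subst (0 <_) (sym (decAt-otherRow M (fromℕ k) (r≢k ∘ sym))) (lastDiagonal-pos A))

rem2-InInt : ∀ {n k} {M : Mat (suc k)} → InInt n (suc k , M) → M (fromℕ k) (fromℕ k) ≡ 1 →
             (∀ i → i Fin.< fromℕ k → M i (fromℕ k) ≡ 0) → InInt (n ∸ 1) (k , rem2 M)
rem2-InInt {k = k} {M} A Mkk≡1 above = mkInInt upper′ (≡suc⇒≡∸1 total≡1+ sumIs) rowNZ′ colNZ′
  where
  open InInt A
  ℓ : Fin (suc k)
  ℓ = fromℕ k
  P : Fin k → Fin (suc k)
  P = punchIn ℓ
  P<ℓ : ∀ a → P a Fin.< ℓ
  P<ℓ a = ≢fromℕ⇒<fromℕ (punchInᵢ≢i ℓ a)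
  rem2≡ : ∀ a b → rem2 M a b ≡ M (P a) (P b)
  rem2≡ a b = sym (cong₂ M (punchIn-fromℕ a) (punchIn-fromℕ b))
  upper′ : ∀ a b → toℕ b < toℕ a → rem2 M a b ≡ 0
  upper′ a b b<a = trans (rem2≡ a b) (upper (P a) (P b) (punchIn-mono-< ℓ b<a))
  rowSum : ∀ a → ΣFin (rem2 M a) ≡ ΣFin (M (P a))
  rowSum a = begin
    ΣFin (rem2 M a)                         ≡⟨ ΣFin-cong (rem2≡ a) ⟩
    0 + ΣFin (λ b → M (P a) (P b))          ≡⟨ cong (_+ ΣFin (λ b → M (P a) (P b))) (sym (above (P a) (P<ℓ a))) ⟩
    M (P a) ℓ + ΣFin (λ b → M (P a) (P b))  ≡⟨ sym (ΣFin-punchIn ℓ (M (P a))) ⟩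
    ΣFin (M (P a))                          ∎
  total≡1+ : total M ≡ suc (total (rem2 M))
  total≡1+ = total-deleteRow ℓ M (rem2 M)
    (trans (ΣFin-single ℓ (λ j j≢ℓ → upper ℓ j (≢fromℕ⇒<fromℕ j≢ℓ))) Mkk≡1) rowSum
  rowNZ′ : ∀ a → ∃ λ j → 0 < rem2 M a j
  rowNZ′ a with rowNZ (P a)
  ... | j , pos with punchIn-preimage ℓ j j≢ℓ
    where
    j≢ℓ : j ≢ ℓ
    j≢ℓ j≡ℓ = n>0⇒n≢0 pos (trans (cong (M (P a)) j≡ℓ) (above (P a) (P<ℓ a)))
  ... | j′ , refl = j′ , subst (0 <_) (sym (rem2≡ a j′)) pos
  colNZ′ : ∀ b → ∃ λ i → 0 < rem2 M i b
  colNZ′ b with colNZ (P b)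
  ... | i , pos with punchIn-preimage ℓ i i≢ℓ
    where
    i≢ℓ : i ≢ ℓ
    i≢ℓ i≡ℓ = n>0⇒n≢0 pos (trans (cong (λ x → M x (P b)) i≡ℓ) (upper ℓ (P b) (P<ℓ b)))
  ... | i′ , refl = i′ , subst (0 <_) (sym (rem2≡ i′ b)) pos

module _ {n k : ℕ} {M : Mat (suc k)} {r : Fin (suc k)} (A : InInt n (suc k , M)) (r≢ℓ : r ≢ fromℕ k)
         (above : ∀ i → i Fin.< r → M i (fromℕ k) ≡ 0) where

  open InInt A
  private
    ℓ : Fin (suc k)
    ℓ = fromℕ k
    P : Fin k → Fin (suc k)
    P = punchIn r

    q : Fin k
    q = proj₁ (punchIn-preimage r ℓ (r≢ℓ ∘ sym))

    Pq≡ℓ : P q ≡ ℓ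
    Pq≡ℓ = proj₂ (punchIn-preimage r ℓ (r≢ℓ ∘ sym))

    belowDiagonal : ∀ a → r Fin.≤ P a → M (P a) r ≡ 0
    belowDiagonal a r≤Pa = upper (P a) r (≤∧≢⇒< r≤Pa (punchInᵢ≢i r a ∘ sym))

  -- Rows above r move their column-r entry into the last column, which was zero there.
  rem3-rowSum : ∀ a → ΣFin (rem3 r M a) ≡ ΣFin (M (P a))
  rem3-rowSum a = byPosition (toℕ (P a) <? toℕ r)
    where
    rest : ℕ
    rest = ΣFin (λ b → M (P a) (P b))
    -- Not a `with`: the same test occurs inside rem3 and would be abstracted there too.
    byPosition : Dec (P a Fin.< r) → ΣFin (rem3 r M a) ≡ ΣFin (M (P a))
    byPosition (yes Pa<r) = begin
      ΣFin (rem3 r M a)                           ≡⟨ ΣFin-fill q (trans (cong (M (P a)) Pq≡ℓ) (above (P a) Pa<r)) kept ⟩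
      rem3 r M a q + rest                         ≡⟨ cong (_+ rest) (rem3-moved r M a q Pq≡ℓ Pa<r) ⟩
      M (P a) r + rest                            ≡⟨ sym (ΣFin-punchIn r (M (P a))) ⟩
      ΣFin (M (P a))                              ∎
      where
      kept : ∀ b → b ≢ q → rem3 r M a b ≡ M (P a) (P b)
      kept b b≢q = rem3-kept r M a b (λ _ Pb≡ℓ → b≢q (punchIn-injective r b q (trans Pb≡ℓ (sym Pq≡ℓ))))
    byPosition (no Pa≮r) = begin
      ΣFin (rem3 r M a)                           ≡⟨ ΣFin-cong (λ b → rem3-kept r M a b (λ Pa<r → contradiction Pa<r Pa≮r)) ⟩
      0 + rest                                    ≡⟨ cong (_+ rest) (sym (belowDiagonal a (≮⇒≥ Pa≮r))) ⟩
      M (P a) r + rest                            ≡⟨ sym (ΣFin-punchIn r (M (P a))) ⟩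
      ΣFin (M (P a))                              ∎

  rem3-InInt : M r ℓ ≡ 1 → (∀ j → j ≢ ℓ → M r j ≡ 0) → InInt (n ∸ 1) (k , rem3 r M)
  rem3-InInt Mrℓ≡1 rowZero = mkInInt upper′ (≡suc⇒≡∸1 total≡1+ sumIs) rowNZ′ colNZ′
    where
    upper′ : ∀ a b → toℕ b < toℕ a → rem3 r M a b ≡ 0
    upper′ a b b<a = trans (rem3-kept r M a b (λ _ Pb≡ℓ → <⇒≱ (subst (Fin._< P a) Pb≡ℓ Pb<Pa) (≤fromℕ (P a))))
                           (upper (P a) (P b) Pb<Pa)
      where
      Pb<Pa : P b Fin.< P a
      Pb<Pa = punchIn-mono-< r b<a
    total≡1+ : total M ≡ suc (total (rem3 r M))
    total≡1+ = total-deleteRow r M (rem3 r M) (trans (ΣFin-single ℓ rowZero) Mrℓ≡1) rem3-rowSum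
    rowNZ′ : ∀ a → ∃ λ j → 0 < rem3 r M a j
    rowNZ′ a with rowNZ (P a)
    ... | j , pos with j ≟ r
    ...   | yes refl = q , subst (0 <_) (sym (rem3-moved r M a q Pq≡ℓ Pa<r)) pos
      where
      Pa<r : P a Fin.< r
      Pa<r = ≰⇒> (λ r≤Pa → n>0⇒n≢0 pos (belowDiagonal a r≤Pa))
    ...   | no j≢r with punchIn-preimage r j j≢r
    ...     | j′ , refl = j′ , subst (0 <_) (sym (rem3-kept r M a j′ notLast)) pos
      where
      notLast : P a Fin.< r → P j′ ≢ ℓ
      notLast Pa<r Pj′≡ℓ = n>0⇒n≢0 pos (trans (cong (M (P a)) Pj′≡ℓ) (above (P a) Pa<r))
    colNZ′ : ∀ b → ∃ λ i → 0 < rem3 r M i b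
    -- Not P b ≟ ℓ, which occurs inside rem3 and would be abstracted by `with`.
    colNZ′ b with ℓ ≟ P b
    ... | yes ℓ≡Pb = q , subst (0 <_) (sym Nqb≡Mℓℓ) (lastDiagonal-pos A)
      where
      ℓ≮r : P q Fin.< r → P b ≢ ℓ
      ℓ≮r Pq<r _ = <⇒≱ (subst (Fin._< r) Pq≡ℓ Pq<r) (≤fromℕ r)
      Nqb≡Mℓℓ : rem3 r M q b ≡ M ℓ ℓ
      Nqb≡Mℓℓ = trans (rem3-kept r M q b ℓ≮r) (cong₂ M Pq≡ℓ (sym ℓ≡Pb))
    ... | no ℓ≢Pb with colNZ (P b)
    ...   | i , pos with punchIn-preimage r i i≢r
      where
      i≢r : i ≢ r
      i≢r i≡r = n>0⇒n≢0 pos (trans (cong (λ x → M x (P b)) i≡r) (rowZero (P b) (ℓ≢Pb ∘ sym)))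
    ...     | i′ , refl = i′ , subst (0 <_) (sym (rem3-kept r M i′ b (λ _ → ℓ≢Pb ∘ sym))) pos

mainTheorem1 : ∀ (n : ℕ) → 2 ≤ n → ∀ (A : SqMat) → InInt n A → InInt (n ∸ 1) (f A)
mainTheorem1 n 2≤n (zero , M) A = contradiction (sym (InInt.sumIs A)) (m<n⇒n≢0 2≤n)
mainTheorem1 n _ (suc k , M) A with firstPos (λ i → M i (fromℕ k)) in first
... | nothing = contradiction (firstPos-nothing (λ i → M i (fromℕ k)) first (fromℕ k))
                              (n>0⇒n≢0 (lastDiagonal-pos A))
... | just r with firstPos-just (λ i → M i (fromℕ k)) first | M r (fromℕ k) in val
...   | pos , _     | zero        = contradiction val (n>0⇒n≢0 pos)
...   | _           | suc (suc m) = decAt-InInt-entry>1 A val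
...   | pos , above | suc zero with r ≟ fromℕ k
...     | yes refl = rem2-InInt A val above
...     | no r≢k with otherPos M r (fromℕ k) in other
...       | true  = let j , j≢k , Mrj>0 = otherPos-true M r (fromℕ k) other
                    in decAt-InInt-lastColumn A r≢k pos j≢k Mrj>0
...       | false = rem3-InInt A r≢k above val (otherPos-false M r (fromℕ k) other)
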